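{- Let $G$ be an undirected graph with at least two stubborn edges. Then no stubborn edge of $G$ has both of its endpoints in the same $\mathscr S$-free component of $G$.
   Context: A walk is a sequence of vertices with consecutive vertices adjacent (vertices and edges may repeat); its length is its number of edges; it is closed if it starts and ends at the same vertex. An edge is stubborn if it belongs to every closed walk of odd length in $G$; $\mathscr S$ is the set of stubborn edges. An $\mathscr S$-free component is the vertex set of a connected component of $G\setminus\mathscr S$ (the graph with all stubborn edges deleted). -}

module Defs where

open import Data.Nat using (ℕ; zero; suc; _+_)
open import Data.Product using (Σ; _×_; _,_; ∃)
open import Data.Sum using (_⊎_)
open import Relation.Nullary using (¬_)
open import Relation.Binary.PropositionalEquality using (_≡_)

record Graph : Set₁ where
  field
    V      : Set
    Adj    : V → V → Set
    sym    : ∀ {u v} → Adj u v → Adj v u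
    irrefl : ∀ {u} → ¬ Adj u u
open Graph public

data Walk {V : Set} (R : V → V → Set) : V → V → Set where
  []  : ∀ {u} → Walk R u u
  _∷_ : ∀ {u v w} → R u v → Walk R v w → Walk R u w

length : ∀ {V : Set} {R : V → V → Set} {u w} → Walk R u w → ℕ
length []      = zero
length (_ ∷ p) = suc (length p)

Odd : ℕ → Set
Odd n = Σ ℕ λ k → n ≡ suc (k + k)

data UsesEdge {V : Set} {R : V → V → Set} (x y : V) :
       ∀ {u w} → Walk R u w → Set where
  here  : ∀ {u v w} (e : R u v) (p : Walk R v w) →
          (u ≡ x × v ≡ y) ⊎ (u ≡ y × v ≡ x) → UsesEdge x y (e ∷ p)
  there : ∀ {u v w} (e : R u v) {p : Walk R v w} →
          UsesEdge x y p → UsesEdge x y (e ∷ p)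

Stubborn : (G : Graph) → V G → V G → Set
Stubborn G x y =
  Adj G x y ×
  (∀ (v : V G) (w : Walk (Adj G) v v) → Odd (length w) → UsesEdge x y w)

AdjMinusS : (G : Graph) → V G → V G → Set
AdjMinusS G u v = Adj G u v × ¬ Stubborn G u v

SameSFreeComponent : (G : Graph) → V G → V G → Set
SameSFreeComponent G u v = Walk (AdjMinusS G) u v

SameEdge : {V : Set} → V → V → V → V → Set
SameEdge x y x' y' = (x ≡ x' × y ≡ y') ⊎ (x ≡ y' × y ≡ x')

AtLeastTwoStubborn : Graph → Set
AtLeastTwoStubborn G =
  Σ (V G) λ x → Σ (V G) λ y → Σ (V G) λ x' → Σ (V G) λ y' →
    Stubborn G x y × Stubborn G x' y' × ¬ SameEdge x y x' y'

-- Let P be a walk from x to y avoiding every stubborn edge, where {x , y} is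
-- stubborn.  If P has even length, the edge x y followed by P backwards is a
-- closed walk of odd length; every stubborn edge lies on it but none lies on
-- P, so every stubborn edge is {x , y}.  If P has odd length, replacing every
-- traversal of {x , y} in a closed walk by P (or P backwards) preserves parity
-- and avoids {x , y}; as {x , y} is stubborn, G has no closed walk of odd
-- length, so every edge is vacuously stubborn, including the first edge of P.
module Submission where

open import Data.Nat.Base using (suc; _+_; parity)
open import Data.Nat.Properties using (+-suc; +-comm)
open import Data.Parity.Base as ℙ using (0ℙ; 1ℙ; _⁻¹)
open import Data.Parity.Properties using (+-homo-+; p+p≡0ℙ)
open import Data.Product.Base using (Σ-syntax; _×_; _,_; proj₁; proj₂)
open import Data.Empty using (⊥-elim)
open import Data.Sum.Base using (_⊎_; inj₁; inj₂; [_,_])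
open import Effect.Monad using (RawMonad)
open import Relation.Nullary.Decidable.Core using (Dec; yes; no; ¬¬-excluded-middle)
open import Relation.Nullary.Negation using (¬_; ¬¬-Monad)
open import Relation.Binary.PropositionalEquality
  using (_≡_; refl; trans; cong; cong₂; module ≡-Reasoning) renaming (sym to ≡-sym)

open import Defs
open ≡-Reasoning

private
  variable
    X : Set
    R S : X → X → Set
    u v w x y a b : X

parity-+-cong : ∀ {m m′ n n′} → parity m ≡ parity m′ → parity n ≡ parity n′ →
                parity (m + n) ≡ parity (m′ + n′)
parity-+-cong {m} {m′} {n} {n′} p q =
  trans (+-homo-+ m n) (trans (cong₂ ℙ._+_ p q) (≡-sym (+-homo-+ m′ n′)))

Odd⇒parity≡1ℙ : ∀ {n} → Odd n → parity n ≡ 1ℙ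
Odd⇒parity≡1ℙ (k , refl) =
  trans (+-homo-+ 1 (k + k)) (cong _⁻¹ (trans (+-homo-+ k k) (p+p≡0ℙ (parity k))))

parity≡1ℙ⇒Odd : ∀ n → parity n ≡ 1ℙ → Odd n
parity≡1ℙ⇒Odd 1 _ = 0 , refl
parity≡1ℙ⇒Odd (suc (suc n)) p with parity≡1ℙ⇒Odd n p
... | k , refl = suc k , cong (λ m → suc (suc m)) (≡-sym (+-suc k k))

map : (∀ {u v} → R u v → S u v) → Walk R u v → Walk S u v
map f []      = []
map f (e ∷ p) = f e ∷ map f p

infixr 5 _++_

_++_ : Walk R u v → Walk R v w → Walk R u w
[]      ++ q = q
(e ∷ p) ++ q = e ∷ (p ++ q)

reverse : (∀ {u v} → R u v → R v u) → Walk R u v → Walk R v u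
reverse s []      = []
reverse s (e ∷ p) = reverse s p ++ (s e ∷ [])

length-map : (f : ∀ {u v} → R u v → S u v) (p : Walk R u v) →
             length (map f p) ≡ length p
length-map f []      = refl
length-map f (e ∷ p) = cong suc (length-map f p)

length-++ : (p : Walk R u v) (q : Walk R v w) →
            length (p ++ q) ≡ length p + length q
length-++ []      q = refl
length-++ (e ∷ p) q = cong suc (length-++ p q)

length-reverse : (s : ∀ {u v} → R u v → R v u) (p : Walk R u v) →
                 length (reverse s p) ≡ length p
length-reverse s []      = refl
length-reverse s (e ∷ p) = begin
  length (reverse s p ++ (s e ∷ [])) ≡⟨ length-++ (reverse s p) (s e ∷ []) ⟩
  length (reverse s p) + 1           ≡⟨ cong (_+ 1) (length-reverse s p) ⟩
  length p + 1                       ≡⟨ +-comm (length p) 1 ⟩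
  suc (length p)                     ∎

UsesEdge-sym : {p : Walk R u v} → UsesEdge x y p → UsesEdge y x p
UsesEdge-sym (here e p (inj₁ (ux , vy))) = here e p (inj₂ (ux , vy))
UsesEdge-sym (here e p (inj₂ (uy , vx))) = here e p (inj₁ (uy , vx))
UsesEdge-sym (there e u)                 = there e (UsesEdge-sym u)

UsesEdge-++⁻ : (p : Walk R u v) (q : Walk R v w) →
               UsesEdge x y (p ++ q) → UsesEdge x y p ⊎ UsesEdge x y q
UsesEdge-++⁻ []      q u            = inj₂ u
UsesEdge-++⁻ (e ∷ p) q (here _ _ h) = inj₁ (here e p h)
UsesEdge-++⁻ (e ∷ p) q (there _ u) with UsesEdge-++⁻ p q u
... | inj₁ uₚ = inj₁ (there e uₚ)
... | inj₂ uᵣ = inj₂ uᵣ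

UsesEdge-reverse⁻ : (s : ∀ {u v} → R u v → R v u) (p : Walk R u v) →
                    UsesEdge x y (reverse s p) → UsesEdge x y p
UsesEdge-reverse⁻ s (e ∷ p) u with UsesEdge-++⁻ (reverse s p) (s e ∷ []) u
... | inj₁ uₚ                               = there e (UsesEdge-reverse⁻ s p uₚ)
... | inj₂ (here _ _ (inj₁ (refl , refl))) = here e p (inj₂ (refl , refl))
... | inj₂ (here _ _ (inj₂ (refl , refl))) = here e p (inj₁ (refl , refl))

Detour : {R : X → X → Set} {u v : X} (x y : X) → Walk R u v → Set
Detour {R = R} {u} {v} x y p =
  Σ[ q ∈ Walk R u v ] parity (length q) ≡ parity (length p) × ¬ UsesEdge x y q

module _ (s : ∀ {u v} → R u v → R v u)
         (P : Walk R x y) (P-odd : parity (length P) ≡ 1ℙ) (P-avoids : ¬ UsesEdge x y P)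
         where

  private
    Pᵣ-odd : parity (length (reverse s P)) ≡ 1ℙ
    Pᵣ-odd = trans (cong parity (length-reverse s P)) P-odd

    Pᵣ-avoids : ¬ UsesEdge x y (reverse s P)
    Pᵣ-avoids u = P-avoids (UsesEdge-reverse⁻ s P u)

    detour-via : (D : Walk R a b) → parity (length D) ≡ 1ℙ → ¬ UsesEdge x y D →
                 (e : R a b) {p : Walk R b w} → Detour x y p → Detour x y (e ∷ p)
    detour-via D D-odd D-avoids e {p} (q , same , q-avoids) =
      D ++ q ,
      trans (cong parity (length-++ D q))
            (parity-+-cong {length D} {1} {length q} {length p} D-odd same) ,
      λ u → [ D-avoids , q-avoids ] (UsesEdge-++⁻ D q u)

    detour-∷ : (e : R u v) {p : Walk R v w} → Detour x y p →
               Dec (u ≡ x × v ≡ y) → Dec (u ≡ y × v ≡ x) → Detour x y (e ∷ p)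
    detour-∷ e {p} d (yes (refl , refl)) _ = detour-via P P-odd P-avoids e {p} d
    detour-∷ e {p} d (no _) (yes (refl , refl)) =
      detour-via (reverse s P) Pᵣ-odd Pᵣ-avoids e {p} d
    detour-∷ e {p} (q , same , q-avoids) (no ¬xy) (no ¬yx) =
      e ∷ q , parity-+-cong {1} {1} {length q} {length p} refl same , λ
        { (here _ _ (inj₁ xy)) → ¬xy xy
        ; (here _ _ (inj₂ yx)) → ¬yx yx
        ; (there _ u)          → q-avoids u
        }

  -- Vertex equality is not decidable, hence the double negation.
  detour : (p : Walk R u v) → ¬ ¬ Detour x y p
  detour []      = λ ¬d → ¬d ([] , refl , λ ())
  detour (e ∷ p) = do
    d   ← detour p
    xy? ← ¬¬-excluded-middle
    yx? ← ¬¬-excluded-middle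
    pure (detour-∷ e {p} d xy? yx?)
    where open RawMonad ¬¬-Monad

SameEdge-euclidean : SameEdge x y a b → SameEdge x y u v → SameEdge a b u v
SameEdge-euclidean (inj₁ (refl , refl)) (inj₁ (refl , refl)) = inj₁ (refl , refl)
SameEdge-euclidean (inj₁ (refl , refl)) (inj₂ (refl , refl)) = inj₂ (refl , refl)
SameEdge-euclidean (inj₂ (refl , refl)) (inj₁ (refl , refl)) = inj₂ (refl , refl)
SameEdge-euclidean (inj₂ (refl , refl)) (inj₂ (refl , refl)) = inj₁ (refl , refl)

module _ (G : Graph) where

  NoOddClosedWalk : Set
  NoOddClosedWalk = ∀ v (c : Walk (Adj G) v v) → ¬ Odd (length c)

  Stubborn-sym : {a b : V G} → Stubborn G a b → Stubborn G b a
  Stubborn-sym (ab , on-odd) = sym G ab , λ v c odd → UsesEdge-sym (on-odd v c odd)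

  forget : {u v : V G} → Walk (AdjMinusS G) u v → Walk (Adj G) u v
  forget = map proj₁

  S-free-walk-avoids : {a b u v : V G} → Stubborn G a b →
                       (p : Walk (AdjMinusS G) u v) → ¬ UsesEdge a b (forget p)
  S-free-walk-avoids sab ((_ , ¬s) ∷ p) (here _ _ (inj₁ (refl , refl))) = ¬s sab
  S-free-walk-avoids sab ((_ , ¬s) ∷ p) (here _ _ (inj₂ (refl , refl))) = ¬s (Stubborn-sym sab)
  S-free-walk-avoids sab (_ ∷ p) (there _ u) = S-free-walk-avoids sab p u

  NoOddClosedWalk⇒Stubborn : {a b : V G} → NoOddClosedWalk → Adj G a b → Stubborn G a b
  NoOddClosedWalk⇒Stubborn none ab = ab , λ v c odd → ⊥-elim (none v c odd)

  odd-S-free-walk⇒NoOddClosedWalk : {x y : V G} → Stubborn G x y →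
    (P : Walk (AdjMinusS G) x y) → parity (length P) ≡ 1ℙ → NoOddClosedWalk
  odd-S-free-walk⇒NoOddClosedWalk sxy P P-odd v c c-odd =
    detour (sym G) (forget P) (trans (cong parity (length-map proj₁ P)) P-odd)
           (S-free-walk-avoids sxy P) c
           λ (c′ , same , c′-avoids) →
             c′-avoids (proj₂ sxy v c′ (parity≡1ℙ⇒Odd _ (trans same (Odd⇒parity≡1ℙ c-odd))))

  S-free-walk-not-odd : {x y : V G} → Stubborn G x y →
                        (P : Walk (AdjMinusS G) x y) → ¬ parity (length P) ≡ 1ℙ
  S-free-walk-not-odd sxy P@((ab , ¬s) ∷ _) P-odd =
    ¬s (NoOddClosedWalk⇒Stubborn (odd-S-free-walk⇒NoOddClosedWalk sxy P P-odd) ab)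

  even-S-free-walk⇒SameEdge : {x y a b : V G} → Stubborn G x y →
    (P : Walk (AdjMinusS G) x y) → parity (length P) ≡ 0ℙ →
    Stubborn G a b → SameEdge x y a b
  even-S-free-walk⇒SameEdge {x} sxy P P-even sab with proj₂ sab x C C-odd
    where
    C : Walk (Adj G) x x
    C = proj₁ sxy ∷ reverse (sym G) (forget P)

    C-odd : Odd (length C)
    C-odd = parity≡1ℙ⇒Odd (length C) (begin
      parity (1 + length (reverse (sym G) (forget P)))
        ≡⟨ +-homo-+ 1 (length (reverse (sym G) (forget P))) ⟩
      parity (length (reverse (sym G) (forget P))) ⁻¹
        ≡⟨ cong (λ n → parity n ⁻¹) (length-reverse (sym G) (forget P)) ⟩
      parity (length (forget P)) ⁻¹
        ≡⟨ cong (λ n → parity n ⁻¹) (length-map proj₁ P) ⟩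
      parity (length P) ⁻¹
        ≡⟨ cong _⁻¹ P-even ⟩
      1ℙ ∎)
  ... | here _ _ (inj₁ (refl , refl)) = inj₁ (refl , refl)
  ... | here _ _ (inj₂ (refl , refl)) = inj₂ (refl , refl)
  ... | there _ u =
    ⊥-elim (S-free-walk-avoids sab P (UsesEdge-reverse⁻ (sym G) (forget P) u))

proposition5 : (G : Graph) → AtLeastTwoStubborn G →
    ∀ (x y : V G) → Stubborn G x y → ¬ SameSFreeComponent G x y
proposition5 G (a , b , a′ , b′ , sab , sa′b′ , distinct) x y sxy P
  with parity (length P) in P-parity
... | 1ℙ = S-free-walk-not-odd G sxy P P-parity
... | 0ℙ = distinct (SameEdge-euclidean (pin sab) (pin sa′b′))
  where
  pin : {u v : V G} → Stubborn G u v → SameEdge x y u v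
  pin = even-S-free-walk⇒SameEdge G sxy P P-parity
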